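{- Let $\Sigma$ be a signature, $T$ the effect-tree monad over $\Sigma$, and $\mathcal{E}\subseteq(T\mathbb{N})^2$ a reflexive, transitive and compositional algebraic relation. Let $c$ be a choice function for $[\mathcal{E}_0]$ and $\alpha=\alpha_c$, with $[\mathcal{E}_0]$ preordered by $\sqsubseteq$. Then for all $a,b\in T\mathbb{N}$, $a\,\mathcal{E}\,b$ implies $a\sqsubseteq_\alpha b$.
   Context: A signature $\Sigma$ is a set of operators with arities in $\mathbb{N}\cup\{\mathbb{N}\}$. For a set $X$, $TX$ is the set of possibly infinite-depth trees with leaves $\bot$, $\top$, or $\langle x\rangle$ ($x\in X$), and internal nodes labelled by operators $\sigma$ with $|\sigma|$ children (indexed by $\mathbb{N}$ if $|\sigma|=\mathbb{N}$). $T$ is a functor ($Tf$ relabels leaves) and a monad with $\eta(x)=\langle x\rangle$ and $\mu$ replacing each leaf $\langle t\rangle$ of a tree in $TTX$ by $t$; $f^*:=\mu\circ Tf$. Let $\mathbf{0}=\emptyset\subseteq\mathbb{N}$, so $T\mathbf{0}\subseteq T\mathbb{N}$ consists of trees with only $\bot,\top$ leaves. An algebraic relation is $\mathcal{E}\subseteq(T\mathbb{N})^2$, written $a\,\mathcal{E}\,b$; compositional means: if $a\,\mathcal{E}\,b$ and $f(n)\,\mathcal{E}\,g(n)$ for all $n$ ($f,g:\mathbb{N}\to T\mathbb{N}$), then $f^*(a)\,\mathcal{E}\,g^*(b)$. Let $\mathcal{E}_0=\mathcal{E}\cap(T\mathbf{0})^2$, $[a]=\{b\in T\mathbf{0}\mid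 a\,\mathcal{E}_0\,b,\ b\,\mathcal{E}_0\,a\}$, $[\mathcal{E}_0]=\{[a]\mid a\in T\mathbf{0}\}$, ordered by $[a]\sqsubseteq[b]$ iff $a\,\mathcal{E}_0\,b$. A choice function is $c:[\mathcal{E}_0]\to T\mathbf{0}$ with $c(S)\in S$; $\alpha_c:=[-]\circ\mu_{\mathbf{0}}\circ Tc:T[\mathcal{E}_0]\to[\mathcal{E}_0]$. For $a,b\in T\mathbb{N}$: $a\sqsubseteq_\alpha b$ iff for every $h:\mathbb{N}\to[\mathcal{E}_0]$, $\alpha(Th(a))\sqsubseteq\alpha(Th(b))$. -}

module Defs where

open import Level using (Level; 0ℓ; _⊔_) renaming (suc to lsuc)
open import Data.Nat using (ℕ; _<_)
open import Data.Empty using (⊥; ⊥-elim)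
open import Data.Unit using (⊤)
open import Data.List using (List; []; _∷_)
open import Data.Product using (Σ; ∃; _×_; _,_; proj₁; proj₂)
open import Function.Bundles using (_⇔_)
open import Relation.Binary.Core using (Rel)
open import Relation.Binary.PropositionalEquality using (_≡_)

data Arity : Set where
  fin   : ℕ → Arity
  omega : Arity

ValidPos : Arity → ℕ → Set
ValidPos (fin n) i = i < n
ValidPos omega   i = ⊤

record Signature : Set₁ where
  field
    Op    : Set
    arity : Op → Arity
open Signature public

-- Possibly infinite-depth effect trees, encoded (no coinduction is
-- available under --safe without --guardedness) as labelling functions
-- on finite paths from the root.  Only the labels at reachable paths
-- matter; trees are compared by the extensional equality _≈T_ below.

Path : Set
Path = List ℕ   -- root-first list of child indices

module _ {Sig : Signature} where

  data Shape {a : Level} (X : Set a) : Set a where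
    ⊥ₛ   : Shape X
    ⊤ₛ   : Shape X
    ⟨_⟩ₛ : X → Shape X
    nodeₛ : Op Sig → Shape X

  T : {a : Level} → Set a → Set a
  T X = Path → Shape X

  sub : {a : Level} {X : Set a} → T X → ℕ → T X
  sub t i p = t (i ∷ p)

  ChildOK : {a : Level} {X : Set a} → Shape X → ℕ → Set
  ChildOK (nodeₛ σ) i = ValidPos (arity Sig σ) i
  ChildOK _         i = ⊥

  Reach : {a : Level} {X : Set a} → T X → Path → Set
  Reach t []      = ⊤
  Reach t (i ∷ p) = ChildOK (t []) i × Reach (sub t i) p

  _≈T_ : {a : Level} {X : Set a} → T X → T X → Set a
  t ≈T u = ∀ p → Reach t p → t p ≡ u p

  smap : {a b : Level} {X : Set a} {Y : Set b} → (X → Y) → Shape X → Shape Y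
  smap f ⊥ₛ        = ⊥ₛ
  smap f ⊤ₛ        = ⊤ₛ
  smap f ⟨ x ⟩ₛ    = ⟨ f x ⟩ₛ
  smap f (nodeₛ σ) = nodeₛ σ

  Tmap : {a b : Level} {X : Set a} {Y : Set b} → (X → Y) → T X → T Y
  Tmap f t p = smap f (t p)

  η : {a : Level} {X : Set a} → X → T X
  η x []      = ⟨ x ⟩ₛ
  η x (_ ∷ _) = ⊥ₛ   -- unreachable

  μ : {a : Level} {X : Set a} → T (T X) → T X
  μ t [] with t []
  ... | ⊥ₛ      = ⊥ₛ
  ... | ⊤ₛ      = ⊤ₛ
  ... | ⟨ s ⟩ₛ  = s []
  ... | nodeₛ σ = nodeₛ σ
  μ t (i ∷ p) with t []
  ... | ⟨ s ⟩ₛ  = s (i ∷ p)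
  ... | nodeₛ σ = μ (sub t i) p
  ... | ⊥ₛ      = ⊥ₛ   -- unreachable
  ... | ⊤ₛ      = ⊥ₛ   -- unreachable

  _* : {a b : Level} {X : Set a} {Y : Set b} → (X → T Y) → T X → T Y
  (f *) t = μ (Tmap f t)

  -- 𝟎 = ∅ ⊆ ℕ; T𝟎 ⊆ Tℕ
  T𝟎 : Set
  T𝟎 = T ⊥

  Tℕ : Set
  Tℕ = T ℕ

  incl : T𝟎 → Tℕ
  incl = Tmap ⊥-elim

module _ {Sig : Signature} (E : Rel (Tℕ {Sig}) 0ℓ) where

  Compositional : Set
  Compositional = ∀ (a b : Tℕ {Sig}) (f g : ℕ → Tℕ {Sig}) →
    E a b → (∀ n → E (f n) (g n)) → E ((f *) a) ((g *) b)

  E₀ : Rel (T𝟎 {Sig}) 0ℓ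
  E₀ a b = E (incl a) (incl b)

  -- elements of [𝓔₀]: subsets S ⊆ T𝟎 of the form [a]
  record Class : Set₁ where
    field
      mem     : T𝟎 {Sig} → Set
      rep     : T𝟎 {Sig}
      isClass : ∀ b → mem b ⇔ (E₀ rep b × E₀ b rep)
  open Class public

  [_] : T𝟎 {Sig} → Class
  [ a ] = record
    { mem     = λ b → E₀ a b × E₀ b a
    ; rep     = a
    ; isClass = λ b → record { to = λ x → x ; from = λ x → x
                             ; to-cong = λ eq → eq ; from-cong = λ eq → eq } }

  -- [a] ⊑ [b] iff a 𝓔₀ b
  _⊑_ : Class → Class → Set
  S ⊑ S′ = Σ (T𝟎 {Sig}) λ a → Σ (T𝟎 {Sig}) λ b →
             mem S a × mem S′ b × E₀ a b

  ChoiceFunction : Set₁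
  ChoiceFunction = Σ (Class → T𝟎 {Sig}) λ c → ∀ S → mem S (c S)

  α : ChoiceFunction → T Class → Class
  α c t = [ μ (Tmap (proj₁ c) t) ]

  _⊑[_]_ : Tℕ {Sig} → ChoiceFunction → Tℕ {Sig} → Set₁
  a ⊑[ c ] b = ∀ (h : ℕ → Class) → α c (Tmap h a) ⊑ α c (Tmap h b)

module Submission where

-- Fix h : ℕ → [𝓔₀] and write c for the choice function.  The class
-- α(T h a) is by definition [μ (T c (T h a))].  The key observation is
-- that, viewed as a tree in Tℕ, this representative is the Kleisli
-- extension f*(a) of the substitution f = incl ∘ c ∘ h.  This is a
-- consequence of two naturality laws of the effect-tree monad, proved
-- first: Kleisli extension absorbs a preceding relabelling, and commutes
-- with a following relabelling.  The theorem follows: from a 𝓔 b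
-- we get f*(a) 𝓔 f*(b), transport this along the naturality equations
-- (𝓔 respects tree equality) and conclude by monotonicity of [-].

open import Defs
open import Level using (Level; 0ℓ)
open import Relation.Binary.Core using (Rel)
open import Relation.Binary.Definitions using (Reflexive; Transitive; _Respects₂_)
open import Relation.Binary.PropositionalEquality using (_≡_; refl; sym; module ≡-Reasoning)
open import Data.Nat using (ℕ)
open import Data.Empty using (⊥-elim)
open import Data.List using ([]; _∷_)
open import Data.Product using (_,_)
open import Function using (_∘_)

pointwise⇒≈T : {Sig : Signature} {a : Level} {X : Set a} {t u : T {Sig} X} →
  (∀ p → t p ≡ u p) → t ≈T u
pointwise⇒≈T t≡u p _ = t≡u p

module _ {Sig : Signature} {a b c : Level} {X : Set a} {Y : Set b} {Z : Set c} where

  kleisli-Tmap : (g : Y → T {Sig} Z) (h : X → Y) (t : T X) →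
    ∀ p → (g *) (Tmap h t) p ≡ ((g ∘ h) *) t p
  kleisli-Tmap g h t [] with t []
  ... | ⊥ₛ      = refl
  ... | ⊤ₛ      = refl
  ... | ⟨ x ⟩ₛ  = refl
  ... | nodeₛ σ = refl
  kleisli-Tmap g h t (i ∷ p) with t []
  ... | ⊥ₛ      = refl
  ... | ⊤ₛ      = refl
  ... | ⟨ x ⟩ₛ  = refl
  ... | nodeₛ σ = kleisli-Tmap g h (sub t i) p

  Tmap-kleisli : (k : Y → Z) (g : X → T {Sig} Y) (t : T X) →
    ∀ p → Tmap k ((g *) t) p ≡ ((Tmap k ∘ g) *) t p
  Tmap-kleisli k g t [] with t []
  ... | ⊥ₛ      = refl
  ... | ⊤ₛ      = refl
  ... | ⟨ x ⟩ₛ  = refl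
  ... | nodeₛ σ = refl
  Tmap-kleisli k g t (i ∷ p) with t []
  ... | ⊥ₛ      = refl
  ... | ⊤ₛ      = refl
  ... | ⟨ x ⟩ₛ  = refl
  ... | nodeₛ σ = Tmap-kleisli k g (sub t i) p

module _ {Sig : Signature} (E : Rel (Tℕ {Sig}) 0ℓ) where

  substitution-stable : Reflexive E → Compositional E →
    (f : ℕ → Tℕ {Sig}) → ∀ {a b} → E a b → E ((f *) a) ((f *) b)
  substitution-stable refl-E comp f {a} {b} aEb =
    comp a b f f aEb (λ _ → refl-E)

  [-]-monotone : Reflexive E → ∀ {a b : T𝟎 {Sig}} → E₀ E a b → _⊑_ E ([_] E a) ([_] E b)
  [-]-monotone refl-E {a} {b} aE₀b = a , b , (refl-E , refl-E) , (refl-E , refl-E) , aE₀b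

  α-rep-as-substitution : (c : Class E → T𝟎 {Sig}) (h : ℕ → Class E) (t : Tℕ {Sig}) →
    ∀ p → ((incl ∘ c ∘ h) *) t p ≡ incl (μ (Tmap c (Tmap h t))) p
  α-rep-as-substitution c h t p = begin
    ((incl ∘ c ∘ h) *) t p             ≡⟨ sym (kleisli-Tmap (incl ∘ c) h t p) ⟩
    ((incl ∘ c) *) (Tmap h t) p        ≡⟨ sym (Tmap-kleisli ⊥-elim c (Tmap h t) p) ⟩
    incl ((c *) (Tmap h t)) p          ∎
    where open ≡-Reasoning

mainTheorem7 : (Sig : Signature) (E : Rel (Tℕ {Sig}) 0ℓ) →
    E Respects₂ (_≈T_ {Sig}) →
    Reflexive E → Transitive E → Compositional E →
    (c : ChoiceFunction E) →
    ∀ (a b : Tℕ {Sig}) → E a b → _⊑[_]_ E a c b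
mainTheorem7 Sig E (resp-right , resp-left) refl-E _ comp (c , _) a b aEb h =
  [-]-monotone E refl-E
    (resp-right (pointwise⇒≈T (α-rep-as-substitution E c h b))
      (resp-left (pointwise⇒≈T (α-rep-as-substitution E c h a))
        (substitution-stable E refl-E comp (incl ∘ c ∘ h) aEb)))
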